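{- Let $\alpha=\alpha_1\cdots\alpha_n$ be a word on which the SR algorithm does not terminate. Then its recording tableau $R(\alpha)$ is a standard tower tableau.
   Context: A cell is a pair $(i,j)$ of integers with $i\ge 1$, $j\ge 0$. A tower diagram is a finite set $\mathcal T$ of cells such that $(i,j)\in\mathcal T$ and $0\le k\le j$ imply $(i,k)\in\mathcal T$; its $i$-th tower is $\mathcal T_i=\{(i,j)\in\mathcal T\}$. The cell $(i,j)$ lies on the diagonal $x+y=i+j$. Flight paths (recursive): a cell $(i,j)\in\mathcal T$ has a flight path in $\mathcal T$ if either (F1) there is no cell $(i',j')\in\mathcal T$ with $i'<i$ and $i'+j'=i+j-1$ (flight path $\{(i,j)\}$), or (F2) such cells exist and, letting $(i',j')$ be the one with largest $i'$, $(i',j')$ has a flight path and $(i',j'+1)\in\mathcal T$ (flight path $\{(i,j),(i',j'+1)\}\cup\mathrm{flightpath}((i',j'),\mathcal T)$). A corner cell of $\mathcal T$ is a cell $(i,j)\in\mathcal T$ with $(i,j+1)\notin\mathcal T$ having a flight path in $\mathcal T$. Sliding: for a positive integer $\alpha$, $\alpha^{\searrow}\mathcal T$ is computed by the procedure $P(\gamma,m)$ started at $\gamma=\alpha$, $m=1$: (S1) if no cell $(i,j)\in\mathcal T$ with $i\ge m$ lies on $x+y=\gamma-1$: (a) if $(\gamma,0)\notin\mathcal T$ the result is $\mathcal T\cup\{(\gamma,0)\}$; (b) if $(\gamma,0)\in\mathcal T$, $(\gamma,1)\notin\mathcal T$ the slide terminates (without result); (c) if $(\gamma,0),(\gamma,1)\in\mathcal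 T$, continue with $P(\gamma+1,\gamma+1)$. (S2) Otherwise let $i\ge m$ be smallest with $(i,\gamma-1-i)\in\mathcal T$: (a) if $(i,\gamma-i)\notin\mathcal T$ the result is $\mathcal T\cup\{(i,\gamma-i)\}$; (b) if $(i,\gamma-i)\in\mathcal T$, $(i,\gamma-i+1)\notin\mathcal T$ the slide terminates; (c) if both are in $\mathcal T$, continue with $P(\gamma+1,i+1)$. A tower tableau of shape $\mathcal T$ (with $|\mathcal T|=n$) is a bijection $f:\mathcal T\to\{1,\dots,n\}$; it is standard if for every $a\in\{1,\dots,n\}$ the set $f^{ -1}(\{1,\dots,a\})$ is a tower diagram and $f^{ -1}(a)$ is a corner cell of it. SR algorithm: for a word $\alpha=\alpha_1\cdots\alpha_n$ of positive integers, set $\mathcal T^{(0)}=\varnothing$ and $\mathcal T^{(k)}=\alpha_k^{\searrow}\mathcal T^{(k-1)}$ for $k=1,\dots,n$; if some slide terminates the algorithm terminates. Otherwise $\mathcal T^{(k)}=\mathcal T^{(k-1)}\cup\{d_k\}$ and the recording tableau $R(\alpha)$ is the tower tableau of shape $\mathcal T^{(n)}$ labelling $d_k$ by $k$. -}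

module Defs where

open import Data.Nat using (ℕ; zero; suc; _+_; _≤_; _<_)
open import Data.Product using (_×_; _,_)
open import Data.List using (List; []; _∷_; _∷ʳ_; length; take; lookup)
open import Data.List.Membership.Propositional using (_∈_; _∉_)
open import Data.List.Relation.Unary.All using (All)
open import Data.List.Relation.Unary.Unique.Propositional using (Unique)
open import Data.Fin using (Fin; toℕ)
open import Relation.Binary.PropositionalEquality using (_≡_; _≢_)

-- A cell (i , j); genuine cells have i ≥ 1.
Cell : Set
Cell = ℕ × ℕ

Diagram : Set
Diagram = List Cell

IsTowerDiagram : Diagram → Set
IsTowerDiagram T =
  (∀ i j → (i , j) ∈ T → 1 ≤ i) ×
  (∀ i j k → (i , j) ∈ T → k ≤ j → (i , k) ∈ T)

-- "(i',j') lies on the diagonal x+y = i+j-1" is written  i' + j' + 1 ≡ i + j.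
-- HasFlightPath T (i , j) : the cell (i , j) has a flight path in T.
data HasFlightPath (T : Diagram) : Cell → Set where
  F1 : ∀ {i j} →
       (∀ i' j' → (i' , j') ∈ T → i' < i → i' + j' + 1 ≢ i + j) →
       HasFlightPath T (i , j)
  F2 : ∀ {i j} i' j' →
       (i' , j') ∈ T → i' < i → i' + j' + 1 ≡ i + j →
       (∀ i'' j'' → (i'' , j'') ∈ T → i'' < i → i'' + j'' + 1 ≡ i + j → i'' ≤ i') →
       HasFlightPath T (i' , j') →
       (i' , suc j') ∈ T →
       HasFlightPath T (i , j)

IsCornerCell : Diagram → Cell → Set
IsCornerCell T (i , j) = (i , j) ∈ T × (i , suc j) ∉ T × HasFlightPath T (i , j)

NoCellOnDiag : Diagram → ℕ → ℕ → Set
NoCellOnDiag T γ m = ∀ i j → (i , j) ∈ T → m ≤ i → i + j + 1 ≢ γ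

SmallestOnDiag : Diagram → ℕ → ℕ → ℕ → ℕ → Set
SmallestOnDiag T γ m i j =
  (i , j) ∈ T × m ≤ i × i + j + 1 ≡ γ ×
  (∀ i' j' → (i' , j') ∈ T → m ≤ i' → i' + j' + 1 ≡ γ → i ≤ i')

-- SlideP T γ m d : the procedure P(γ, m) on T yields the result T ∪ {d}.
-- (Cases (S1b), (S2b) -- termination without result -- have no constructor.)
data SlideP (T : Diagram) : ℕ → ℕ → Cell → Set where
  S1a : ∀ {γ m} → NoCellOnDiag T γ m → (γ , 0) ∉ T → SlideP T γ m (γ , 0)
  S1c : ∀ {γ m d} → NoCellOnDiag T γ m → (γ , 0) ∈ T → (γ , 1) ∈ T →
        SlideP T (suc γ) (suc γ) d → SlideP T γ m d
  S2a : ∀ {γ m} i j → SmallestOnDiag T γ m i j → (i , suc j) ∉ T →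
        SlideP T γ m (i , suc j)
  S2c : ∀ {γ m d} i j → SmallestOnDiag T γ m i j →
        (i , suc j) ∈ T → (i , suc (suc j)) ∈ T →
        SlideP T (suc γ) (suc i) d → SlideP T γ m d

Slide : ℕ → Diagram → Cell → Set
Slide α T d = SlideP T α 1 d

-- SRRun α ds : the SR algorithm on the word α does not terminate and the
-- k-th slide adds the cell d_k, where ds = d_1 ⋯ d_n (so T^(k) = {d_1,…,d_k}).
data SRRun : List ℕ → List Cell → Set where
  done : SRRun [] []
  step : ∀ {α ds a d} → SRRun α ds → Slide a ds d → SRRun (α ∷ʳ a) (ds ∷ʳ d)

-- A tower tableau with n cells is encoded by the list ds = f⁻¹(1) ⋯ f⁻¹(n)
-- of its cells (distinct); its shape is the set of entries of ds.
-- Standard: for each a, f⁻¹{1..a} = take a ds is a tower diagram and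
-- f⁻¹(a) is a corner cell of it.
IsStandardTowerTableau : List Cell → Set
IsStandardTowerTableau ds =
  Unique ds ×
  IsTowerDiagram ds ×
  (∀ (k : Fin (length ds)) →
     IsTowerDiagram (take (suc (toℕ k)) ds) ×
     IsCornerCell (take (suc (toℕ k)) ds) (lookup ds k))

-- Each slide places its new cell d on top of a tower, so the diagram stays a tower diagram, and
-- d is a corner cell: on the diagonal just below d, the slide chose its cells leftmost-first, so
-- the cell (p , q) it bumped last is the rightmost one left of d; by induction along the slide
-- it has a flight path, and (p , q + 1) lies above it, so clause F2 applies (F1 if nothing was
-- bumped). That flight path survives adding d, since it only inspects lower diagonals.
module Submission where

open import Defs
open import Data.Nat using (ℕ; suc; _+_; _≤_; _<_; _≤?_; z≤n; s≤s; s≤s⁻¹)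
open import Data.Nat.Properties
  using ( ≤-refl; ≤-trans; ≤-reflexive; ≰⇒>; <⇒≱; n≤1+n; m≤n⇒m<n∨m≡n
        ; +-suc; +-comm; +-identityʳ; m≤m+n; m+1+n≰m)
open import Data.List using (List; []; _∷_; _∷ʳ_; length; take; lookup)
open import Data.List.Relation.Unary.All using (All; [])
open import Data.List.Relation.Unary.All.Properties using (∷ʳ⁻)
open import Data.List.Relation.Unary.Any using (here)
open import Data.List.Membership.Propositional using (_∈_; _∉_)
open import Data.List.Membership.Propositional.Properties using (∈-++⁺ˡ; ∈-++⁺ʳ; ∈-++⁻)
open import Data.List.Relation.Unary.Unique.Propositional using (Unique)
open import Data.List.Relation.Unary.AllPairs using ([]; _∷_)
import Data.List.Relation.Unary.Unique.Propositional.Properties as Unique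
open import Data.Fin as Fin using (Fin; toℕ)
open import Data.Product using (_×_; _,_)
open import Data.Sum using (_⊎_; inj₁; inj₂)
open import Data.Empty using (⊥; ⊥-elim)
open import Relation.Nullary using (yes; no)
open import Relation.Binary.PropositionalEquality using (_≡_; _≢_; refl; sym; trans)

private
  variable
    A : Set
    T : Diagram
    γ m : ℕ

∈-∷ʳ⁻ : ∀ {v d : A} xs → v ∈ xs ∷ʳ d → v ∈ xs ⊎ v ≡ d
∈-∷ʳ⁻ xs v∈ with ∈-++⁻ xs v∈
... | inj₁ v∈xs = inj₁ v∈xs
... | inj₂ (here v≡d) = inj₂ v≡d

∈-∷ʳ⁺ʳ : ∀ xs (d : A) → d ∈ xs ∷ʳ d
∈-∷ʳ⁺ʳ xs d = ∈-++⁺ʳ xs (here refl)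

unique-∷ʳ : ∀ {xs} {d : A} → Unique xs → d ∉ xs → Unique (xs ∷ʳ d)
unique-∷ʳ xs! d∉xs = Unique.++⁺ xs! ([] ∷ []) λ { (d∈xs , here refl) → d∉xs d∈xs }

prefixes-∷ʳ : ∀ (P : List A → A → Set) xs d →
  (∀ (k : Fin (length xs)) → P (take (suc (toℕ k)) xs) (lookup xs k)) →
  P (xs ∷ʳ d) d →
  ∀ (k : Fin (length (xs ∷ʳ d))) → P (take (suc (toℕ k)) (xs ∷ʳ d)) (lookup (xs ∷ʳ d) k)
prefixes-∷ʳ P []       d _   Pd Fin.zero    = Pd
prefixes-∷ʳ P (x ∷ xs) d Pxs Pd Fin.zero    = Pxs Fin.zero
prefixes-∷ʳ P (x ∷ xs) d Pxs Pd (Fin.suc k) =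
  prefixes-∷ʳ (λ ys → P (x ∷ ys)) xs d (λ k → Pxs (Fin.suc k)) Pd k

n+1≡k⇒k≰n : ∀ {n k} → n + 1 ≡ k → k ≤ n → ⊥
n+1≡k⇒k≰n {n} refl = m+1+n≰m n

m+1+n≡m+n+1 : ∀ i j → i + suc j ≡ i + j + 1
m+1+n≡m+n+1 i j = trans (+-suc i j) (+-comm 1 (i + j))

+1≡suc : ∀ {n k} → n ≡ k → n + 1 ≡ suc k
+1≡suc {k = k} refl = +-comm k 1

flightPath-∷ʳ : ∀ {a b x y} → a + b ≤ x + y →
  HasFlightPath T (a , b) → HasFlightPath (T ∷ʳ (x , y)) (a , b)
flightPath-∷ʳ {T = T} {a} {b} {x} {y} ab≤xy (F1 none) = F1 none'
  where
  none' : ∀ i' j' → (i' , j') ∈ T ∷ʳ (x , y) → i' < a → i' + j' + 1 ≢ a + b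
  none' i' j' c∈ i'<a on with ∈-∷ʳ⁻ T c∈
  ... | inj₁ c∈T  = none i' j' c∈T i'<a on
  ... | inj₂ refl = n+1≡k⇒k≰n on ab≤xy
flightPath-∷ʳ {T = T} {a} {b} {x} {y} ab≤xy (F2 i' j' c∈ i'<a on rightmost fp above) =
  F2 i' j' (∈-++⁺ˡ c∈) i'<a on rightmost' (flightPath-∷ʳ lower fp) (∈-++⁺ˡ above)
  where
  lower : i' + j' ≤ x + y
  lower = ≤-trans (≤-trans (m≤m+n (i' + j') 1) (≤-reflexive on)) ab≤xy
  rightmost' : ∀ i'' j'' → (i'' , j'') ∈ T ∷ʳ (x , y) → i'' < a →
    i'' + j'' + 1 ≡ a + b → i'' ≤ i'
  rightmost' i'' j'' c∈' i''<a on' with ∈-∷ʳ⁻ T c∈'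
  ... | inj₁ c∈T  = rightmost i'' j'' c∈T i''<a on'
  ... | inj₂ refl = ⊥-elim (n+1≡k⇒k≰n on' ab≤xy)

-- The state in which P(γ, m) is entered: either m = 1, or m = p + 1 where the previous step
-- bumped (p , q) on the diagonal x + y = γ - 1 via rule (c).
data SlideEntry (T : Diagram) (γ : ℕ) : ℕ → Set where
  start  : SlideEntry T γ 1
  bumped : ∀ p q → (p , q) ∈ T → (p , suc q) ∈ T → p + q + 1 ≡ γ →
           HasFlightPath T (p , q) → SlideEntry T γ (suc p)

entry-positive : SlideEntry T γ m → 1 ≤ m
entry-positive start                = ≤-refl
entry-positive (bumped _ _ _ _ _ _) = s≤s z≤n

entry-≤ : 1 ≤ γ → SlideEntry T γ m → m ≤ γ
entry-≤ 1≤γ start                   = 1≤γ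
entry-≤ _   (bumped p q _ _ refl _) = ≤-trans (m≤m+n (suc p) q) (≤-reflexive (+-comm 1 (p + q)))

DiagonalGap : Diagram → ℕ → ℕ → ℕ → Set
DiagonalGap T γ m a = ∀ i' j' → (i' , j') ∈ T → m ≤ i' → i' < a → i' + j' + 1 ≢ γ

flightPath-entry : ∀ {a b} → (∀ i j → (i , j) ∈ T → 1 ≤ i) → SlideEntry T γ m →
  m ≤ a → a + b ≡ γ → DiagonalGap T γ m a → HasFlightPath T (a , b)
flightPath-entry positive start _ on gap =
  F1 λ i' j' c∈ i'<a on' → gap i' j' c∈ (positive i' j' c∈) i'<a (trans on' on)
flightPath-entry {T = T} {a = a} {b} _ (bumped p q pq∈ above on-p fp) p<a on gap =
  F2 p q pq∈ p<a (trans on-p (sym on)) rightmost fp above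
  where
  rightmost : ∀ i'' j'' → (i'' , j'') ∈ T → i'' < a → i'' + j'' + 1 ≡ a + b → i'' ≤ p
  rightmost i'' j'' c∈ i''<a on' with i'' ≤? p
  ... | yes i''≤p = i''≤p
  ... | no  i''≰p = ⊥-elim (gap i'' j'' c∈ (≰⇒> i''≰p) i''<a (trans on' on))

on-next-diagonal : ∀ {i j} → SmallestOnDiag T γ m i j → i + suc j ≡ γ
on-next-diagonal {i = i} {j} (_ , _ , on , _) = trans (m+1+n≡m+n+1 i j) on

noCell-gap : ∀ {a} → NoCellOnDiag T γ m → DiagonalGap T γ m a
noCell-gap none i' j' c∈ m≤i' _ = none i' j' c∈ m≤i'

smallest-gap : ∀ {i j} → SmallestOnDiag T γ m i j → DiagonalGap T γ m i
smallest-gap (_ , _ , _ , leftmost) i' j' c∈ m≤i' i'<i on = <⇒≱ i'<i (leftmost i' j' c∈ m≤i' on)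

data Supported (T : Diagram) : Cell → Set where
  ground : ∀ {a} → Supported T (a , 0)
  onTop  : ∀ {a b} → (a , b) ∈ T → Supported T (a , suc b)

supported-downward : ∀ {a b} → IsTowerDiagram T → Supported T (a , b) →
  ∀ k → k ≤ b → (a , k) ∈ T ∷ʳ (a , b)
supported-downward {T = T} _ ground _ z≤n = ∈-∷ʳ⁺ʳ T _
supported-downward {T = T} (_ , downward) (onTop ab∈T) k k≤1+b with m≤n⇒m<n∨m≡n k≤1+b
... | inj₁ k<1+b = ∈-++⁺ˡ (downward _ _ k ab∈T (s≤s⁻¹ k<1+b))
... | inj₂ refl  = ∈-∷ʳ⁺ʳ T _

CornerExtension : Diagram → Cell → Set
CornerExtension T d = d ∉ T × IsTowerDiagram (T ∷ʳ d) × IsCornerCell (T ∷ʳ d) d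

cornerExtension : ∀ {a b} → IsTowerDiagram T → 1 ≤ a → Supported T (a , b) → (a , b) ∉ T →
  HasFlightPath T (a , b) → CornerExtension T (a , b)
cornerExtension {T = T} {a} {b} tower@(positive , downward) 1≤a support d∉T fp =
  d∉T , (positive' , downward') , ∈-∷ʳ⁺ʳ T d , top∉ , flightPath-∷ʳ ≤-refl fp
  where
  d = (a , b)
  positive' : ∀ i j → (i , j) ∈ T ∷ʳ d → 1 ≤ i
  positive' i j c∈ with ∈-∷ʳ⁻ T c∈
  ... | inj₁ c∈T  = positive i j c∈T
  ... | inj₂ refl = 1≤a
  downward' : ∀ i j k → (i , j) ∈ T ∷ʳ d → k ≤ j → (i , k) ∈ T ∷ʳ d
  downward' i j k c∈ k≤j with ∈-∷ʳ⁻ T c∈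
  ... | inj₁ c∈T  = ∈-++⁺ˡ (downward i j k c∈T k≤j)
  ... | inj₂ refl = supported-downward tower support k k≤j
  top∉ : (a , suc b) ∉ T ∷ʳ d
  top∉ c∈ with ∈-∷ʳ⁻ T c∈
  ... | inj₁ c∈T = d∉T (downward a (suc b) b c∈T (n≤1+n b))
  ... | inj₂ ()

slide-cornerExtension : ∀ {d} → IsTowerDiagram T → 1 ≤ γ → SlideEntry T γ m →
  SlideP T γ m d → CornerExtension T d
slide-cornerExtension tower@(positive , _) 1≤γ entry (S1a none γ0∉T) =
  cornerExtension tower 1≤γ ground γ0∉T
    (flightPath-entry positive entry (entry-≤ 1≤γ entry) (+-identityʳ _)
      (noCell-gap none))
slide-cornerExtension {T = T} {γ = γ} tower@(positive , _) 1≤γ entry (S1c none γ0∈T γ1∈T next) =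
  slide-cornerExtension tower (s≤s z≤n) (bumped γ 0 γ0∈T γ1∈T (+1≡suc (+-identityʳ γ)) fp) next
  where
  fp : HasFlightPath T (γ , 0)
  fp = flightPath-entry positive entry (entry-≤ 1≤γ entry) (+-identityʳ γ)
         (noCell-gap none)
slide-cornerExtension tower@(positive , _) _ entry (S2a i j smallest@(ij∈T , m≤i , _) top∉T) =
  cornerExtension tower (≤-trans (entry-positive entry) m≤i) (onTop ij∈T) top∉T
    (flightPath-entry positive entry m≤i (on-next-diagonal smallest) (smallest-gap smallest))
slide-cornerExtension {T = T} tower@(positive , _) _ entry
                      (S2c i j smallest@(_ , m≤i , _) top∈T above∈T next) =
  slide-cornerExtension tower (s≤s z≤n)
    (bumped i (suc j) top∈T above∈T (+1≡suc (on-next-diagonal smallest)) fp) next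
  where
  fp : HasFlightPath T (i , suc j)
  fp = flightPath-entry positive entry m≤i (on-next-diagonal smallest) (smallest-gap smallest)

lemma3p9 : (α : List ℕ) → All (1 ≤_) α → (ds : List Cell) → SRRun α ds →
    IsStandardTowerTableau ds
lemma3p9 _ _ _ done = [] , ((λ _ _ ()) , (λ _ _ _ ())) , λ ()
lemma3p9 _ 1≤α _ (step {α} {ds} {d = d} run slide) =
  let 1≤α′ , 1≤a = ∷ʳ⁻ 1≤α
      ds! , tower , prefixes = lemma3p9 α 1≤α′ ds run
      d∉ds , tower′ , corner = slide-cornerExtension tower 1≤a start slide
  in unique-∷ʳ ds! d∉ds , tower′ ,
     prefixes-∷ʳ (λ T c → IsTowerDiagram T × IsCornerCell T c) ds d prefixes (tower′ , corner)
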